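{- Let $n>1$ be an integer. Then the set $\widetilde{n}_{(1,n-1)}(\Sigma_n)=\{\widetilde{n}_{(1,n-1)}(F): F\in\Sigma_n\}$ equals \[ L(n):=\{ -n+2\}\cup\{k\in\mathbb{Z}: -n+4\le k\le n-3\}\cup\{0\}\cup\{n\}. \]
   Context: A set composition of $[n]=\{1,\ldots,n\}$ is a tuple $F=(F_1,\ldots,F_k)$ of nonempty, pairwise disjoint subsets of $[n]$ whose union is $[n]$; its length is $\ell(F)=k$ and its type is the composition $(|F_1|,\ldots,|F_k|)$ of $n$. $\Sigma_n$ denotes the set of all set compositions of $[n]$. For $F,G\in\Sigma_n$ write $F\preceq G$ if every block of $F$ is a subset of some block of $G$. For a composition $\alpha$ of $n$ (a tuple of positive integers summing to $n$), the knapsack number is $n_\alpha(F)=\#\{G\in\Sigma_n: F\preceq G,\ \operatorname{type}G=\alpha\}$, and the signed knapsack number is $\widetilde{n}_\alpha(F)=(-1)^{n-\ell(F)}n_\alpha(F)$. -}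

module Defs where

open import Data.Nat using (ℕ; zero; suc; _∸_)
import Data.Nat as ℕ
open import Data.Vec.Properties using (≡-dec)
open import Data.Integer as ℤ using (ℤ; +_; -_; _^_; _*_; _+_; _≤_; -1ℤ)
open import Data.Fin using (Fin; _≟_)
open import Data.Fin.Properties using (all?; any?)
open import Data.Vec as Vec using (Vec; []; _∷_; lookup)
open import Data.List as List using (List; [_]; concatMap; allFin; filter; length)
open import Data.Product using (Σ; ∃; _×_; _,_; proj₁)
open import Data.Sum using (_⊎_)
open import Relation.Binary.PropositionalEquality using (_≡_)
open import Relation.Nullary using (Dec; _×-dec_; _→-dec_)

-- A set composition of [n] = {1..n} (elements encoded as Fin n) with k blocks
-- is encoded by its block-label vector f : Vec (Fin k) n, where element x lies
-- in block F_(i) iff lookup f x ≡ i.  Blocks are pairwise disjoint and cover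
-- [n] automatically; nonemptiness of each block is surjectivity of f.
Surjective : ∀ {n k} → Vec (Fin k) n → Set
Surjective {n} {k} f = ∀ (i : Fin k) → ∃ λ (x : Fin n) → lookup f x ≡ i

surjective? : ∀ {n k} (f : Vec (Fin k) n) → Dec (Surjective f)
surjective? f = all? (λ i → any? (λ x → lookup f x ≟ i))

SetComp : ℕ → Set
SetComp n = Σ ℕ λ k → Σ (Vec (Fin k) n) Surjective

len : ∀ {n} → SetComp n → ℕ
len (k , _) = k

blockSize : ∀ {n k} → Vec (Fin k) n → Fin k → ℕ
blockSize f i = Vec.count (λ y → y ≟ i) f

typeOf : ∀ {n k} → Vec (Fin k) n → Vec ℕ k
typeOf f = Vec.tabulate (blockSize f)

Refines : ∀ {n k m} → Vec (Fin k) n → Vec (Fin m) n → Set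
Refines {n} {k} {m} f g =
  ∀ (i : Fin k) → ∃ λ (j : Fin m) → ∀ (x : Fin n) → lookup f x ≡ i → lookup g x ≡ j

refines? : ∀ {n k m} (f : Vec (Fin k) n) (g : Vec (Fin m) n) → Dec (Refines f g)
refines? f g = all? (λ i → any? (λ j → all? (λ x → (lookup f x ≟ i) →-dec (lookup g x ≟ j))))

allVecs : ∀ {m} (n : ℕ) → List (Vec (Fin m) n)
allVecs zero = [ [] ]
allVecs {m} (suc n) = concatMap (λ i → List.map (i ∷_) (allVecs n)) (allFin m)

-- knapsack number n_α(F) = #{G ∈ Σ_n : F ⪯ G, type G = α}
-- (a set composition G of type α has exactly length α blocks)
knapsack : ∀ {n} → (α : List ℕ) → SetComp n → ℕ
knapsack {n} α (k , f , _) =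
  length (filter (λ g → surjective? g ×-dec (refines? f g ×-dec
                    ≡-dec ℕ._≟_ (typeOf g) (Vec.fromList α)))
                 (allVecs {List.length α} n))

signedKnapsack : ∀ {n} → (α : List ℕ) → SetComp n → ℤ
signedKnapsack {n} α F = (-1ℤ ^ (n ∸ len F)) * (+ knapsack α F)

InL : ℕ → ℤ → Set
InL n m =
  m ≡ (- (+ n)) + (+ 2)
  ⊎ ((- (+ n)) + (+ 4) ≤ m × m ≤ (+ n) ℤ.- (+ 3))
  ⊎ m ≡ + 0
  ⊎ m ≡ + n

{-# OPTIONS --safe #-}

-- A set composition G of type (1, n-1) lies above F exactly when its first block {x}
-- is a singleton block of F.  Hence n_(1,n-1)(F) is the number s of singleton blocks
-- of F, and ñ_(1,n-1)(F) = (-1)^(n-k) s when F has k blocks.  The triples (n, k, s)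
-- that occur are those obtained by adding blocks of positive size one at a time; they
-- satisfy s ≤ k and 2k ≤ n + s, and s = k forces n = s, which confines (-1)^(n-k) s
-- to L(n).  Conversely each element of L(n) is the value of s singletons together
-- with one or two further blocks, the number of further blocks fixing the sign.

module Submission where

open import Defs
open import Data.Nat using (ℕ; _<_; _∸_)
open import Data.Integer using (ℤ)
open import Data.List using (_∷_; [])
open import Data.Product using (∃)
open import Relation.Binary.PropositionalEquality using (_≡_)
open import Function.Bundles using (_⇔_)

open import Data.Bool using (true; false; if_then_else_)
open import Data.Empty using (⊥-elim)
open import Data.Fin using (Fin; zero; suc; _≟_; _↑ʳ_; punchIn)
open import Data.Fin.Properties using (punchInᵢ≢i; 0≢1+n; ¬Fin0)
import Data.Fin.Properties as Fin
open import Data.Integer as ℤ using (+_; -_; -[1+_]; 0ℤ; 1ℤ; -1ℤ)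
import Data.Integer.Properties as ℤP
open import Data.Integer.Tactic.RingSolver using (solve-∀)
open import Data.List as List using (List; filter; length; _++_; concatMap; tabulate)
open import Data.List.Properties using (filter-++; length-++; filter-none; filter-accept)
import Data.List.Relation.Unary.All as All
import Data.Nat as ℕ
open import Data.Nat using (zero; suc; _+_; _*_; _≤_; z≤n; s≤s; z<s)
open import Data.Nat.Properties
  using ( +-identityʳ; *-identityʳ; *-zeroʳ; *-distribʳ-+; +-suc; suc-injective
        ; n∸n≡0; m∸n+n≡m; m+n∸n≡m; m≤n⇒∃[o]m+o≡n
        ; ≤-refl; ≤-trans; ≤-antisym; <⇒≤; <⇒≱; ≤∧≢⇒<; n≮n; 1+n≰n
        ; m≤m+n; m≤n+m; +-mono-≤; +-monoʳ-≤; +-cancelˡ-≤; +-cancelʳ-≤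
        ; module ≤-Reasoning; +-commutativeSemigroup; +-*-semiring )
open import Data.Product using (Σ; _×_; _,_; proj₁; proj₂)
open import Data.Sum using (_⊎_; inj₁; inj₂)
open import Data.Vec as Vec using (Vec; _∷_; []; lookup; replicate; _[_]≔_)
open import Data.Vec.Properties
  using ( ∷-injectiveˡ; ∷-injectiveʳ; lookup∘update; lookup∘update′; lookup-replicate
        ; lookup-++ʳ; lookup-map )
open import Function using (_∘_; id)
open import Function.Bundles using (mk⇔; Equivalence)
open import Relation.Binary.PropositionalEquality
  using (_≢_; refl; sym; trans; cong; cong₂; subst; module ≡-Reasoning)
open import Relation.Nullary using (Dec; does; yes; no; ¬_)
open import Relation.Unary using (Decidable)
open import Algebra.Properties.CommutativeSemigroup +-commutativeSemigroup
  using (interchange; xy∙z≈xz∙y)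
open import Algebra.Properties.Semiring.Sum +-*-semiring
  using (sum-cong-≗; ∑-distrib-+; sum-replicate-zero; sum-syntax)

module _ {A : Set} {P : A → Set} (P? : Decidable P) where

  length-filter-++ : ∀ xs ys →
    length (filter P? (xs ++ ys)) ≡ length (filter P? xs) + length (filter P? ys)
  length-filter-++ xs ys = trans (cong length (filter-++ P? xs ys)) (length-++ (filter P? xs))

  length-filter-map : ∀ {B : Set} (h : B → A) xs →
    length (filter P? (List.map h xs)) ≡ length (filter (P? ∘ h) xs)
  length-filter-map h [] = refl
  length-filter-map h (x ∷ xs) with does (P? (h x))
  ... | true  = cong suc (length-filter-map h xs)
  ... | false = length-filter-map h xs

  length-filter-none : (∀ x → ¬ P x) → ∀ xs → length (filter P? xs) ≡ 0
  length-filter-none ¬P xs = cong length (filter-none P? (All.universal ¬P xs))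

  length-filter-concatMap-tabulate : ∀ {B : Set} (F : B → List A) {k} (g : Fin k → B) →
    length (filter P? (concatMap F (tabulate g))) ≡ ∑[ i < k ] length (filter P? (F (g i)))
  length-filter-concatMap-tabulate F {zero} g = refl
  length-filter-concatMap-tabulate F {suc k} g =
    trans (length-filter-++ (F (g zero)) _)
          (cong (_+_ (length (filter P? (F (g zero))))) (length-filter-concatMap-tabulate F (g ∘ suc)))

indicator : ∀ {X : Set} → Dec X → ℕ
indicator X? = if does X? then 1 else 0

∑-indicator-* : ∀ {k} (a : Fin k) (h : Fin k → ℕ) →
  ∑[ i < k ] (indicator (a ≟ i) * h i) ≡ h a
∑-indicator-* {suc k} zero h =
  trans (cong₂ _+_ (+-identityʳ (h zero)) (sum-replicate-zero k)) (+-identityʳ (h zero))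
∑-indicator-* {suc k} (suc a) h = ∑-indicator-* a (h ∘ suc)

length-filter-allVecs-suc : ∀ {m} n {P : Vec (Fin m) (suc n) → Set} (P? : Decidable P) →
  length (filter P? (allVecs (suc n))) ≡ ∑[ i < m ] length (filter (P? ∘ (i ∷_)) (allVecs n))
length-filter-allVecs-suc n P? =
  trans (length-filter-concatMap-tabulate P? (λ i → List.map (i ∷_) (allVecs n)) id)
        (sum-cong-≗ (λ i → length-filter-map P? (i ∷_) (allVecs n)))

length-filter-allVecs-unique : ∀ {m} n {P : Vec (Fin m) n → Set} (P? : Decidable P)
  (v : Vec (Fin m) n) → (∀ g → P g → g ≡ v) → P v → length (filter P? (allVecs n)) ≡ 1
length-filter-allVecs-unique zero P? [] _ Pv = cong length (filter-accept P? Pv)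
length-filter-allVecs-unique {m} (suc n) P? (a ∷ v) only Pv = begin
  length (filter P? (allVecs (suc n)))                  ≡⟨ length-filter-allVecs-suc n P? ⟩
  ∑[ i < m ] length (filter (P? ∘ (i ∷_)) (allVecs n))  ≡⟨ sum-cong-≗ count-with-head ⟩
  ∑[ i < m ] (indicator (a ≟ i) * 1)                    ≡⟨ ∑-indicator-* a (λ _ → 1) ⟩
  1                                                     ∎
  where
  open ≡-Reasoning
  count-with-head : ∀ i → length (filter (P? ∘ (i ∷_)) (allVecs n)) ≡ indicator (a ≟ i) * 1
  count-with-head i with a ≟ i
  ... | yes refl = length-filter-allVecs-unique n (P? ∘ (a ∷_)) v
                     (λ g P[ag] → ∷-injectiveʳ (only _ P[ag])) Pv
  ... | no a≢i   = length-filter-none (P? ∘ (i ∷_))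
                     (λ g P[ig] → a≢i (sym (∷-injectiveˡ (only _ P[ig])))) (allVecs n)

blockSize-∷ : ∀ {n k} (a : Fin k) (f : Vec (Fin k) n) i →
  blockSize (a ∷ f) i ≡ indicator (a ≟ i) + blockSize f i
blockSize-∷ a f i with does (a ≟ i)
... | true  = refl
... | false = refl

∑-lookup≡∑-blockSize-* : ∀ {n k} (f : Vec (Fin k) n) (h : Fin k → ℕ) →
  ∑[ x < n ] h (lookup f x) ≡ ∑[ i < k ] (blockSize f i * h i)
∑-lookup≡∑-blockSize-* {k = k} [] h = sym (sum-replicate-zero k)
∑-lookup≡∑-blockSize-* {k = k} (a ∷ f) h = begin
  h a + ∑[ x < _ ] h (lookup f x)
    ≡⟨ cong₂ _+_ (sym (∑-indicator-* a h)) (∑-lookup≡∑-blockSize-* f h) ⟩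
  ∑[ i < k ] (indicator (a ≟ i) * h i) + ∑[ i < k ] (blockSize f i * h i)
    ≡⟨ ∑-distrib-+ (λ i → indicator (a ≟ i) * h i) (λ i → blockSize f i * h i) ⟨
  ∑[ i < k ] (indicator (a ≟ i) * h i + blockSize f i * h i)
    ≡⟨ sum-cong-≗ (λ i → *-distribʳ-+ (h i) (indicator (a ≟ i)) (blockSize f i)) ⟨
  ∑[ i < k ] ((indicator (a ≟ i) + blockSize f i) * h i)
    ≡⟨ sum-cong-≗ (λ i → cong (_* h i) (blockSize-∷ a f i)) ⟨
  ∑[ i < k ] (blockSize (a ∷ f) i * h i)
    ∎
  where open ≡-Reasoning

∑-1 : ∀ n → ∑[ x < n ] 1 ≡ n
∑-1 zero    = refl
∑-1 (suc n) = cong suc (∑-1 n)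

∑-blockSize : ∀ {n k} (f : Vec (Fin k) n) → ∑[ i < k ] blockSize f i ≡ n
∑-blockSize {n} f = begin
  ∑[ i < _ ] blockSize f i        ≡⟨ sum-cong-≗ (λ i → *-identityʳ (blockSize f i)) ⟨
  ∑[ i < _ ] (blockSize f i * 1)  ≡⟨ ∑-lookup≡∑-blockSize-* f (λ _ → 1) ⟨
  ∑[ x < n ] 1                    ≡⟨ ∑-1 n ⟩
  n                               ∎
  where open ≡-Reasoning

0<blockSize : ∀ {n k} (f : Vec (Fin k) n) {i} y → lookup f y ≡ i → 0 < blockSize f i
0<blockSize (a ∷ f) zero refl with a ≟ a
... | yes _  = z<s
... | no a≢a = ⊥-elim (a≢a refl)
0<blockSize (a ∷ f) {i} (suc y) fy≡i with a ≟ i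
... | yes _ = z<s
... | no _  = 0<blockSize f y fy≡i

∉⇒blockSize≡0 : ∀ {n k} (f : Vec (Fin k) n) {i} →
  (∀ y → lookup f y ≢ i) → blockSize f i ≡ 0
∉⇒blockSize≡0 [] _ = refl
∉⇒blockSize≡0 (a ∷ f) {i} ∉ with a ≟ i
... | yes a≡i = ⊥-elim (∉ zero a≡i)
... | no _    = ∉⇒blockSize≡0 f (∉ ∘ suc)

blockSize≡0⇒∉ : ∀ {n k} (f : Vec (Fin k) n) {i} y → blockSize f i ≡ 0 → lookup f y ≢ i
blockSize≡0⇒∉ f y size≡0 fy≡i = n≮n 0 (subst (0 <_) size≡0 (0<blockSize f y fy≡i))

unique⇒blockSize≡1 : ∀ {n k} (f : Vec (Fin k) n) {i} x → lookup f x ≡ i →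
  (∀ y → lookup f y ≡ i → y ≡ x) → blockSize f i ≡ 1
unique⇒blockSize≡1 (a ∷ f) {i} zero a≡i unique with a ≟ i
... | yes _  = cong suc (∉⇒blockSize≡0 f (λ y fy≡i → 0≢1+n (sym (unique (suc y) fy≡i))))
... | no a≢i = ⊥-elim (a≢i a≡i)
unique⇒blockSize≡1 (a ∷ f) {i} (suc x) fx≡i unique with a ≟ i
... | yes a≡i = ⊥-elim (0≢1+n (unique zero a≡i))
... | no _    =
  unique⇒blockSize≡1 f x fx≡i (λ y fy≡i → Fin.suc-injective (unique (suc y) fy≡i))

blockSize≡1⇒unique : ∀ {n k} (f : Vec (Fin k) n) {i} x y → blockSize f i ≡ 1 →
  lookup f x ≡ i → lookup f y ≡ i → y ≡ x
blockSize≡1⇒unique (a ∷ f) {i} x y size fx≡i fy≡i with a ≟ i | x | y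
... | yes _   | zero   | zero   = refl
... | yes _   | zero   | suc y′ = ⊥-elim (blockSize≡0⇒∉ f y′ (suc-injective size) fy≡i)
... | yes _   | suc x′ | _      = ⊥-elim (blockSize≡0⇒∉ f x′ (suc-injective size) fx≡i)
... | no a≢i  | zero   | _      = ⊥-elim (a≢i fx≡i)
... | no a≢i  | suc _  | zero   = ⊥-elim (a≢i fy≡i)
... | no _    | suc x′ | suc y′ = cong suc (blockSize≡1⇒unique f x′ y′ size fx≡i fy≡i)

isolate : ∀ {n} → Fin n → Vec (Fin 2) n
isolate {n} x = replicate n (suc zero) [ x ]≔ zero

lookup-isolate-self : ∀ {n} (x : Fin n) → lookup (isolate x) x ≡ zero
lookup-isolate-self {n} x = lookup∘update x (replicate n (suc zero)) zero

lookup-isolate-other : ∀ {n} {x y : Fin n} → y ≢ x → lookup (isolate x) y ≡ suc zero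
lookup-isolate-other {n} {x} {y} y≢x =
  trans (lookup∘update′ y≢x (replicate n (suc zero)) zero) (lookup-replicate y (suc zero))

lookup-isolate≡zero⇒ : ∀ {n} (x y : Fin n) → lookup (isolate x) y ≡ zero → y ≡ x
lookup-isolate≡zero⇒ x y isolated with y ≟ x
... | yes y≡x = y≡x
... | no y≢x  = ⊥-elim (0≢1+n (trans (sym isolated) (lookup-isolate-other y≢x)))

blockSize-isolate-zero : ∀ {n} (x : Fin n) → blockSize (isolate x) zero ≡ 1
blockSize-isolate-zero x =
  unique⇒blockSize≡1 (isolate x) x (lookup-isolate-self x) (lookup-isolate≡zero⇒ x)

blockSize-isolate-one : ∀ {m} (x : Fin (suc m)) → blockSize (isolate x) (suc zero) ≡ m
blockSize-isolate-one {m} x = trans (sym (+-identityʳ rest)) (suc-injective (begin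
  1 + (rest + 0)                      ≡⟨ cong (_+ (rest + 0)) (blockSize-isolate-zero x) ⟨
  ∑[ i < 2 ] blockSize (isolate x) i  ≡⟨ ∑-blockSize (isolate x) ⟩
  suc m                               ∎))
  where
  open ≡-Reasoning
  rest = blockSize (isolate x) (suc zero)

typeOf-isolate : ∀ {m} (x : Fin (suc m)) → typeOf (isolate x) ≡ 1 ∷ m ∷ []
typeOf-isolate x =
  cong₂ (λ a b → a ∷ b ∷ []) (blockSize-isolate-zero x) (blockSize-isolate-one x)

blockSize≡0⇒all-one : ∀ {n} (g : Vec (Fin 2) n) →
  blockSize g zero ≡ 0 → g ≡ replicate n (suc zero)
blockSize≡0⇒all-one [] _ = refl
blockSize≡0⇒all-one (suc zero ∷ g) size = cong (suc zero ∷_) (blockSize≡0⇒all-one g size)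

blockSize≡1⇒isolate : ∀ {n} (g : Vec (Fin 2) n) →
  blockSize g zero ≡ 1 → ∃ λ x → g ≡ isolate x
blockSize≡1⇒isolate (zero ∷ g) size =
  zero , cong (zero ∷_) (blockSize≡0⇒all-one g (suc-injective size))
blockSize≡1⇒isolate (suc zero ∷ g) size =
  let x , g≡isolate = blockSize≡1⇒isolate g size in suc x , cong (suc zero ∷_) g≡isolate

length-filter-allVecs-isolate : ∀ n {P : Vec (Fin 2) n → Set} (P? : Decidable P)
  {S : Fin n → Set} (S? : Decidable S) →
  (∀ g → P g → ∃ λ x → g ≡ isolate x × S x) → (∀ x → S x → P (isolate x)) →
  length (filter P? (allVecs n)) ≡ ∑[ x < n ] indicator (S? x)
length-filter-allVecs-isolate zero P? S? sound _ =
  length-filter-none P? (λ g → ¬Fin0 ∘ proj₁ ∘ sound g) (allVecs 0)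
length-filter-allVecs-isolate (suc n) {P} P? {S} S? sound complete = begin
  length (filter P? (allVecs (suc n)))
    ≡⟨ length-filter-allVecs-suc n P? ⟩
  length (filter (P? ∘ (zero ∷_)) (allVecs n))
    + (length (filter (P? ∘ (suc zero ∷_)) (allVecs n)) + 0)
    ≡⟨ cong₂ _+_ head-zero (trans (+-identityʳ _) head-one) ⟩
  indicator (S? zero) + ∑[ x < n ] indicator (S? (suc x))
    ∎
  where
  open ≡-Reasoning
  sound-zero : ∀ g → P (zero ∷ g) → g ≡ replicate n (suc zero) × S zero
  sound-zero g P[0g] with sound (zero ∷ g) P[0g]
  ... | zero  , refl , S0 = refl , S0
  ... | suc _ , ()   , _

  sound-one : ∀ g → P (suc zero ∷ g) → ∃ λ x → g ≡ isolate x × S (suc x)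
  sound-one g P[1g] with sound (suc zero ∷ g) P[1g]
  ... | zero  , ()   , _
  ... | suc x , refl , Sx = x , refl , Sx

  head-zero : length (filter (P? ∘ (zero ∷_)) (allVecs n)) ≡ indicator (S? zero)
  head-zero with S? zero
  ... | yes S0 = length-filter-allVecs-unique n (P? ∘ (zero ∷_)) (replicate n (suc zero))
                   (λ g → proj₁ ∘ sound-zero g) (complete zero S0)
  ... | no ¬S0 =
    length-filter-none (P? ∘ (zero ∷_)) (λ g → ¬S0 ∘ proj₂ ∘ sound-zero g) (allVecs n)

  head-one : length (filter (P? ∘ (suc zero ∷_)) (allVecs n)) ≡ ∑[ x < n ] indicator (S? (suc x))
  head-one =
    length-filter-allVecs-isolate n (P? ∘ (suc zero ∷_)) (S? ∘ suc) sound-one (complete ∘ suc)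

IsolatingCoarsening : ∀ {n k} → Vec (Fin k) n → Vec (Fin 2) n → Set
IsolatingCoarsening {n} f g = Surjective g × Refines f g × typeOf g ≡ 1 ∷ n ∸ 1 ∷ []

InSingleton : ∀ {n k} → Vec (Fin k) n → Fin n → Set
InSingleton f x = blockSize f (lookup f x) ≡ 1

isolatingCoarsening⇒isolate : ∀ {n k} (f : Vec (Fin k) n) g →
  IsolatingCoarsening f g → ∃ λ x → g ≡ isolate x × InSingleton f x
isolatingCoarsening⇒isolate f g (_ , refines , type)
  with blockSize≡1⇒isolate g (∷-injectiveˡ type)
... | x , refl with refines (lookup f x)
... | j , sameBlock = x , refl , unique⇒blockSize≡1 f x refl isolated
  where
  isolated : ∀ y → lookup f y ≡ lookup f x → y ≡ x
  isolated y fy≡fx = lookup-isolate≡zero⇒ x y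
    (trans (sameBlock y fy≡fx) (trans (sym (sameBlock x refl)) (lookup-isolate-self x)))

isolate⇒isolatingCoarsening : ∀ {m k} (f : Vec (Fin k) (suc (suc m))) x →
  InSingleton f x → IsolatingCoarsening f (isolate x)
isolate⇒isolatingCoarsening f x singleton = surjective , refines , typeOf-isolate x
  where
  surjective : Surjective (isolate x)
  surjective zero       = x , lookup-isolate-self x
  surjective (suc zero) = punchIn x zero , lookup-isolate-other (punchInᵢ≢i x zero)
  refines : Refines f (isolate x)
  refines i with i ≟ lookup f x
  ... | yes refl = zero , λ y fy≡fx →
    subst (λ z → lookup (isolate x) z ≡ zero)
          (sym (blockSize≡1⇒unique f x y singleton refl fy≡fx)) (lookup-isolate-self x)
  ... | no i≢fx  = suc zero , λ y fy≡i →
    lookup-isolate-other (λ y≡x → i≢fx (trans (sym fy≡i) (cong (lookup f) y≡x)))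

isOne : ℕ → ℕ
isOne c = indicator (c ℕ.≟ 1)

n*isOne[n]≡isOne[n] : ∀ n → n * isOne n ≡ isOne n
n*isOne[n]≡isOne[n] zero          = refl
n*isOne[n]≡isOne[n] (suc zero)    = refl
n*isOne[n]≡isOne[n] (suc (suc n)) = *-zeroʳ (suc (suc n))

singletons : ∀ {n} → SetComp n → ℕ
singletons (k , f , _) = ∑[ i < k ] isOne (blockSize f i)

knapsack[1,n-1]≡singletons : ∀ {n} → 1 < n → (F : SetComp n) →
  knapsack (1 ∷ n ∸ 1 ∷ []) F ≡ singletons F
knapsack[1,n-1]≡singletons {n} (s≤s (s≤s z≤n)) F@(k , f , _) = begin
  knapsack (1 ∷ n ∸ 1 ∷ []) F
    ≡⟨ length-filter-allVecs-isolate n _ (λ x → blockSize f (lookup f x) ℕ.≟ 1)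
         (isolatingCoarsening⇒isolate f) (isolate⇒isolatingCoarsening f) ⟩
  ∑[ x < n ] isOne (blockSize f (lookup f x))
    ≡⟨ ∑-lookup≡∑-blockSize-* f (isOne ∘ blockSize f) ⟩
  ∑[ i < k ] (blockSize f i * isOne (blockSize f i))
    ≡⟨ sum-cong-≗ (n*isOne[n]≡isOne[n] ∘ blockSize f) ⟩
  ∑[ i < k ] isOne (blockSize f i)
    ∎
  where open ≡-Reasoning

data Profile : ℕ → ℕ → ℕ → Set where
  empty : Profile 0 0 0
  block : ∀ {b n k s} → 0 < b → Profile n k s → Profile (b + n) (suc k) (isOne b + s)

profile-of-sizes : ∀ {k} (b : Fin k → ℕ) → (∀ i → 0 < b i) →
  Profile (∑[ i < k ] b i) k (∑[ i < k ] isOne (b i))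
profile-of-sizes {zero}  b positive = empty
profile-of-sizes {suc k} b positive =
  block (positive zero) (profile-of-sizes (b ∘ suc) (positive ∘ suc))

profile : ∀ {n} (F : SetComp n) → Profile n (len F) (singletons F)
profile (k , f , surjective) =
  subst (λ n → Profile n k (∑[ i < k ] isOne (blockSize f i))) (∑-blockSize f)
        (profile-of-sizes (blockSize f) nonEmpty)
  where
  nonEmpty : ∀ i → 0 < blockSize f i
  nonEmpty i = let y , fy≡i = surjective i in 0<blockSize f y fy≡i

blockSize-map-suc-zero : ∀ {n k} (f : Vec (Fin k) n) → blockSize (Vec.map suc f) zero ≡ 0
blockSize-map-suc-zero []      = refl
blockSize-map-suc-zero (_ ∷ f) = blockSize-map-suc-zero f

blockSize-map-suc : ∀ {n k} (f : Vec (Fin k) n) i →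
  blockSize (Vec.map suc f) (suc i) ≡ blockSize f i
blockSize-map-suc []      i = refl
blockSize-map-suc (a ∷ f) i with a ≟ i
... | yes _ = cong suc (blockSize-map-suc f i)
... | no _  = blockSize-map-suc f i

module _ {n k} (f : Vec (Fin k) n) where

  blockSize-prepend-zero : ∀ b → blockSize (replicate b zero Vec.++ Vec.map suc f) zero ≡ b
  blockSize-prepend-zero zero    = blockSize-map-suc-zero f
  blockSize-prepend-zero (suc b) = cong suc (blockSize-prepend-zero b)

  blockSize-prepend-suc : ∀ b i →
    blockSize (replicate b zero Vec.++ Vec.map suc f) (suc i) ≡ blockSize f i
  blockSize-prepend-suc zero    i = blockSize-map-suc f i
  blockSize-prepend-suc (suc b) i = blockSize-prepend-suc b i

addBlock : ∀ b {n} → SetComp n → SetComp (suc b + n)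
addBlock b (k , f , surjective) = suc k , replicate (suc b) zero Vec.++ Vec.map suc f , surjective′
  where
  surjective′ : Surjective (replicate (suc b) zero Vec.++ Vec.map suc f)
  surjective′ zero    = zero , refl
  surjective′ (suc i) = let x , fx≡i = surjective i in
    suc b ↑ʳ x , trans (lookup-++ʳ (replicate (suc b) zero) (Vec.map suc f) x)
                       (trans (lookup-map x suc f) (cong suc fx≡i))

singletons-addBlock : ∀ b {n} (F : SetComp n) →
  singletons (addBlock b F) ≡ isOne (suc b) + singletons F
singletons-addBlock b (k , f , _) =
  cong₂ _+_ (cong isOne (blockSize-prepend-zero f (suc b)))
            (sum-cong-≗ (cong isOne ∘ blockSize-prepend-suc f (suc b)))

realize : ∀ {n k s} → Profile n k s → Σ (SetComp n) λ F → len F ≡ k × singletons F ≡ s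
realize empty = (0 , [] , λ ()) , refl , refl
realize (block {suc b} _ p) with realize p
... | F , refl , refl = addBlock b F , refl , singletons-addBlock b F

isOne[n]≤1 : ∀ n → isOne n ≤ 1
isOne[n]≤1 zero          = z≤n
isOne[n]≤1 (suc zero)    = ≤-refl
isOne[n]≤1 (suc (suc n)) = z≤n

2≤n+isOne[n] : ∀ {n} → 0 < n → 2 ≤ n + isOne n
2≤n+isOne[n] {suc zero}    _ = ≤-refl
2≤n+isOne[n] {suc (suc n)} _ = s≤s (s≤s z≤n)

singletons≤blocks : ∀ {n k s} → Profile n k s → s ≤ k
singletons≤blocks empty                = z≤n
singletons≤blocks (block {b = b} _ p) = +-mono-≤ (isOne[n]≤1 b) (singletons≤blocks p)

blocks+blocks≤size+singletons : ∀ {n k s} → Profile n k s → k + k ≤ n + s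
blocks+blocks≤size+singletons empty = z≤n
blocks+blocks≤size+singletons (block {b} {n} {k} {s} 0<b p) = begin
  suc k + suc k            ≡⟨ cong suc (+-suc k k) ⟩
  2 + (k + k)              ≤⟨ +-mono-≤ (2≤n+isOne[n] 0<b) (blocks+blocks≤size+singletons p) ⟩
  (b + isOne b) + (n + s)  ≡⟨ interchange b (isOne b) n s ⟩
  (b + n) + (isOne b + s)  ∎
  where open ≤-Reasoning

singletons≡blocks⇒size≡blocks : ∀ {n k s} → Profile n k s → s ≡ k → n ≡ k
singletons≡blocks⇒size≡blocks empty refl = refl
singletons≡blocks⇒size≡blocks (block {suc zero} _ p) s≡k =
  cong suc (singletons≡blocks⇒size≡blocks p (suc-injective s≡k))
singletons≡blocks⇒size≡blocks (block {suc (suc _)} _ p) s≡1+k =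
  ⊥-elim (1+n≰n (subst (_≤ _) s≡1+k (singletons≤blocks p)))

signedCount : ℕ → ℕ → ℕ → ℤ
signedCount n k s = -1ℤ ℤ.^ (n ∸ k) ℤ.* + s

signedKnapsack[1,n-1]≡signedCount : ∀ {n} → 1 < n → (F : SetComp n) →
  signedKnapsack (1 ∷ n ∸ 1 ∷ []) F ≡ signedCount n (len F) (singletons F)
signedKnapsack[1,n-1]≡signedCount {n} 1<n F =
  cong (λ c → -1ℤ ℤ.^ (n ∸ len F) ℤ.* + c) (knapsack[1,n-1]≡singletons 1<n F)

signedCount-diagonal : ∀ n → signedCount n n n ≡ + n
signedCount-diagonal n =
  trans (cong (λ d → -1ℤ ℤ.^ d ℤ.* + n) (n∸n≡0 n)) (ℤP.*-identityˡ (+ n))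

-1^[1+n]≡-[-1^n] : ∀ n → -1ℤ ℤ.^ suc n ≡ - (-1ℤ ℤ.^ n)
-1^[1+n]≡-[-1^n] n = ℤP.-1*i≡-i (-1ℤ ℤ.^ n)

-1^[2+n]≡-1^n : ∀ n → -1ℤ ℤ.^ (2 + n) ≡ -1ℤ ℤ.^ n
-1^[2+n]≡-1^n n =
  trans (-1^[1+n]≡-[-1^n] (suc n)) (trans (cong -_ (-1^[1+n]≡-[-1^n] n)) (ℤP.neg-involutive _))

-1^[3+n]≡-[-1^n] : ∀ n → -1ℤ ℤ.^ (3 + n) ≡ - (-1ℤ ℤ.^ n)
-1^[3+n]≡-[-1^n] n = trans (-1^[1+n]≡-[-1^n] (2 + n)) (cong -_ (-1^[2+n]≡-1^n n))

-1^n≡1⊎-1^n≡-1 : ∀ n → -1ℤ ℤ.^ n ≡ 1ℤ ⊎ -1ℤ ℤ.^ n ≡ -1ℤ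
-1^n≡1⊎-1^n≡-1 zero          = inj₁ refl
-1^n≡1⊎-1^n≡-1 (suc zero)    = inj₂ refl
-1^n≡1⊎-1^n≡-1 (suc (suc n)) =
  subst (λ σ → σ ≡ 1ℤ ⊎ σ ≡ -1ℤ) (sym (-1^[2+n]≡-1^n n)) (-1^n≡1⊎-1^n≡-1 n)

pattern lowest eq    = inj₁ eq
pattern middle lo hi = inj₂ (inj₁ (lo , hi))
pattern nought eq    = inj₂ (inj₂ (inj₁ eq))
pattern highest eq   = inj₂ (inj₂ (inj₂ eq))

+a≤+n-+b⇔b+a≤n : ∀ {a b n} → + a ℤ.≤ + n ℤ.- + b ⇔ b + a ≤ n
+a≤+n-+b⇔b+a≤n {a} {b} {n} = mk⇔ to from
  where
  open ℤP.≤-Reasoning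
  x+[y-x]≡y : ∀ x y → x ℤ.+ (y ℤ.- x) ≡ y
  x+[y-x]≡y = solve-∀
  [x+y]-x≡y : ∀ x y → x ℤ.+ y ℤ.- x ≡ y
  [x+y]-x≡y = solve-∀
  to : + a ℤ.≤ + n ℤ.- + b → b + a ≤ n
  to a≤n-b = ℤP.drop‿+≤+ (begin
    + (b + a)              ≡⟨ ℤP.pos-+ b a ⟩
    + b ℤ.+ + a            ≤⟨ ℤP.+-monoʳ-≤ (+ b) a≤n-b ⟩
    + b ℤ.+ (+ n ℤ.- + b)  ≡⟨ x+[y-x]≡y (+ b) (+ n) ⟩
    + n                    ∎)
  from : b + a ≤ n → + a ℤ.≤ + n ℤ.- + b
  from b+a≤n = begin
    + a                    ≡⟨ [x+y]-x≡y (+ b) (+ a) ⟨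
    + b ℤ.+ + a ℤ.- + b    ≡⟨ cong (ℤ._- + b) (ℤP.pos-+ b a) ⟨
    + (b + a) ℤ.- + b      ≤⟨ ℤP.+-monoˡ-≤ (- + b) (ℤ.+≤+ b+a≤n) ⟩
    + n ℤ.- + b            ∎

-+n++b≤-+a⇔b+a≤n : ∀ {a b n} → - + n ℤ.+ + b ℤ.≤ - + a ⇔ b + a ≤ n
-+n++b≤-+a⇔b+a≤n {a} {b} {n} = mk⇔
  (λ le → to (ℤP.neg-cancel-≤ (subst (ℤ._≤ - + a) -n+b≡-[n-b] le)))
  (λ le → subst (ℤ._≤ - + a) (sym -n+b≡-[n-b]) (ℤP.neg-mono-≤ (from le)))
  where
  open Equivalence +a≤+n-+b⇔b+a≤n
  -x+y≡-[x-y] : ∀ x y → - x ℤ.+ y ≡ - (x ℤ.- y)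
  -x+y≡-[x-y] = solve-∀
  -n+b≡-[n-b] : - + n ℤ.+ + b ≡ - (+ n ℤ.- + b)
  -n+b≡-[n-b] = -x+y≡-[x-y] (+ n) (+ b)

-[2+n]+2≡-n : ∀ n → - + (2 + n) ℤ.+ + 2 ≡ - + n
-[2+n]+2≡-n n = trans (ℤP.-m+n≡n⊖m (2 + n) 2) (trans (ℤP.+-cancelˡ-⊖ 2 0 n) (ℤP.⊖-≤ z≤n))

InL-lowest : ∀ s → InL (2 + s) (- + s)
InL-lowest s = lowest (sym (-[2+n]+2≡-n s))

InL-positive : ∀ {n s} → 0 < s → 3 + s ≤ n → InL n (+ s)
InL-positive {n} {s} 0<s 3+s≤n =
  middle (ℤP.≤-trans -n+4≤0 (ℤ.+≤+ z≤n)) (Equivalence.from +a≤+n-+b⇔b+a≤n 3+s≤n)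
  where
  -n+4≤0 : - + n ℤ.+ + 4 ℤ.≤ - + 0
  -n+4≤0 = Equivalence.from -+n++b≤-+a⇔b+a≤n (≤-trans (+-monoʳ-≤ 3 0<s) 3+s≤n)

InL-negative : ∀ {n s} → 4 + s ≤ n → InL n (- + s)
InL-negative {n} {s} 4+s≤n =
  middle (Equivalence.from -+n++b≤-+a⇔b+a≤n 4+s≤n) (ℤP.≤-trans ℤP.neg-≤-pos 0≤n-3)
  where
  0≤n-3 : + 0 ℤ.≤ + n ℤ.- + 3
  0≤n-3 = Equivalence.from +a≤+n-+b⇔b+a≤n (≤-trans (m≤m+n 3 (suc s)) 4+s≤n)

InL-of-nonSingletonBlock : ∀ d {k s} → 0 < s → s < k → k + k ≤ d + k + s →
  InL (d + k) (-1ℤ ℤ.^ d ℤ.* + s)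
InL-of-nonSingletonBlock zero {k} _ s<k 2k≤k+s = ⊥-elim (<⇒≱ s<k (+-cancelˡ-≤ k k _ 2k≤k+s))
InL-of-nonSingletonBlock 1 {k} {s} _ s<k 2k≤1+k+s with ≤-antisym k≤1+s s<k
  where
  k≤1+s : k ≤ suc s
  k≤1+s = +-cancelˡ-≤ k k (suc s) (subst (k + k ≤_) (sym (+-suc k s)) 2k≤1+k+s)
... | refl = subst (InL (2 + s)) (sym (ℤP.-1*i≡-i (+ s))) (InL-lowest s)
InL-of-nonSingletonBlock (suc (suc d)) {k} {s} 0<s s<k _ with -1^n≡1⊎-1^n≡-1 d
... | inj₁ -1^d≡1 = subst (InL (2 + d + k)) (sym value) (InL-positive 0<s 3+s≤2+d+k)
  where
  3+s≤2+d+k : 3 + s ≤ 2 + d + k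
  3+s≤2+d+k = s≤s (s≤s (≤-trans s<k (m≤n+m k d)))
  value : -1ℤ ℤ.^ (2 + d) ℤ.* + s ≡ + s
  value = trans (cong (ℤ._* + s) (trans (-1^[2+n]≡-1^n d) -1^d≡1)) (ℤP.*-identityˡ (+ s))
InL-of-nonSingletonBlock (suc (suc zero)) _ _ _ | inj₂ ()
InL-of-nonSingletonBlock (suc (suc (suc d))) {k} {s} _ s<k _ | inj₂ -1^[1+d]≡-1 =
  subst (InL (3 + d + k)) (sym value) (InL-negative 4+s≤3+d+k)
  where
  4+s≤3+d+k : 4 + s ≤ 3 + d + k
  4+s≤3+d+k = s≤s (s≤s (s≤s (≤-trans s<k (m≤n+m k d))))
  value : -1ℤ ℤ.^ (3 + d) ℤ.* + s ≡ - + s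
  value =
    trans (cong (ℤ._* + s) (trans (-1^[2+n]≡-1^n (suc d)) -1^[1+d]≡-1)) (ℤP.-1*i≡-i (+ s))

InL-of-profile : ∀ {n k s} → Profile n k s → InL n (signedCount n k s)
InL-of-profile {n} {k} {zero} _ = nought (ℤP.*-zeroʳ (-1ℤ ℤ.^ (n ∸ k)))
InL-of-profile {n} {k} {suc s} p with suc s ℕ.≟ k
... | yes refl = subst (λ n → InL n (signedCount n k k)) (sym (singletons≡blocks⇒size≡blocks p refl))
                       (highest (signedCount-diagonal k))
... | no s≢k = subst (λ n′ → InL n′ (signedCount n k (suc s))) n∸k+k≡n
                     (InL-of-nonSingletonBlock (n ∸ k) z<s s<k
                       (subst (λ m → k + k ≤ m + suc s) (sym n∸k+k≡n) bound))
  where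
  s<k : suc s < k
  s<k = ≤∧≢⇒< (singletons≤blocks p) s≢k
  bound : k + k ≤ n + suc s
  bound = blocks+blocks≤size+singletons p
  n∸k+k≡n : n ∸ k + k ≡ n
  n∸k+k≡n = m∸n+n≡m (+-cancelʳ-≤ k k n (≤-trans bound (+-monoʳ-≤ n (<⇒≤ s<k))))

Attained : ℕ → ℤ → Set
Attained n m = ∃ λ k → ∃ λ s → Profile n k s × signedCount n k s ≡ m

attained-of-sign≡1 : ∀ {n k s} → Profile n k s → -1ℤ ℤ.^ (n ∸ k) ≡ 1ℤ → Attained n (+ s)
attained-of-sign≡1 {s = s} p sign≡1 =
  _ , _ , p , trans (cong (ℤ._* + s) sign≡1) (ℤP.*-identityˡ (+ s))

attained-of-sign≡-1 : ∀ {n k s} → Profile n k s → -1ℤ ℤ.^ (n ∸ k) ≡ -1ℤ →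
  Attained n (- + s)
attained-of-sign≡-1 {s = s} p sign≡-1 =
  _ , _ , p , trans (cong (ℤ._* + s) sign≡-1) (ℤP.-1*i≡-i (+ s))

allSingletons : ∀ s → Profile s s s
allSingletons zero    = empty
allSingletons (suc s) = block {1} z<s (allSingletons s)

oneBlockOver : ∀ b s → Profile (2 + b + s) (1 + s) s
oneBlockOver b s = block {2 + b} z<s (allSingletons s)

twoBlocksOver : ∀ b s → Profile (2 + (2 + b + s)) (2 + s) s
twoBlocksOver b s = block {2} z<s (oneBlockOver b s)

sign-oneBlockOver : ∀ b s → -1ℤ ℤ.^ (2 + b + s ∸ (1 + s)) ≡ -1ℤ ℤ.^ (1 + b)
sign-oneBlockOver b s = cong (-1ℤ ℤ.^_) (m+n∸n≡m (1 + b) s)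

sign-twoBlocksOver : ∀ b s → -1ℤ ℤ.^ (4 + b + s ∸ (2 + s)) ≡ -1ℤ ℤ.^ b
sign-twoBlocksOver b s = trans (cong (-1ℤ ℤ.^_) (m+n∸n≡m (2 + b) s)) (-1^[2+n]≡-1^n b)

attained-highest : ∀ n → Attained n (+ n)
attained-highest n = attained-of-sign≡1 (allSingletons n) (cong (-1ℤ ℤ.^_) (n∸n≡0 n))

attained-nought : ∀ {n} → 1 < n → Attained n 0ℤ
attained-nought (s≤s (s≤s {n = b} z≤n)) =
  1 , 0 , subst (λ n → Profile n 1 0) (+-identityʳ (2 + b)) (oneBlockOver b 0) ,
  ℤP.*-zeroʳ (-1ℤ ℤ.^ suc b)

attained-lowest : ∀ s → Attained (2 + s) (- + s)
attained-lowest s = attained-of-sign≡-1 (oneBlockOver 0 s) (sign-oneBlockOver 0 s)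

attained-positive : ∀ b s → Attained (3 + b + s) (+ s)
attained-positive zero    s = attained-of-sign≡1 (oneBlockOver 1 s) (sign-oneBlockOver 1 s)
attained-positive (suc b) s with -1^n≡1⊎-1^n≡-1 b
... | inj₁ -1^b≡1  =
  attained-of-sign≡1 (twoBlocksOver b s) (trans (sign-twoBlocksOver b s) -1^b≡1)
... | inj₂ -1^b≡-1 = attained-of-sign≡1 (oneBlockOver (2 + b) s)
  (trans (sign-oneBlockOver (2 + b) s) (trans (-1^[3+n]≡-[-1^n] b) (cong -_ -1^b≡-1)))

attained-negative : ∀ b s → Attained (4 + b + s) (- + s)
attained-negative b s with -1^n≡1⊎-1^n≡-1 b
... | inj₁ -1^b≡1  = attained-of-sign≡-1 (oneBlockOver (2 + b) s)
  (trans (sign-oneBlockOver (2 + b) s) (trans (-1^[3+n]≡-[-1^n] b) (cong -_ -1^b≡1)))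
... | inj₂ -1^b≡-1 =
  attained-of-sign≡-1 (twoBlocksOver b s) (trans (sign-twoBlocksOver b s) -1^b≡-1)

m+n≤o⇒∃[d]m+d+n≡o : ∀ m {n o} → m + n ≤ o → ∃ λ d → m + d + n ≡ o
m+n≤o⇒∃[d]m+d+n≡o m {n} m+n≤o =
  let d , m+n+d≡o = m≤n⇒∃[o]m+o≡n m+n≤o in d , trans (xy∙z≈xz∙y m d n) m+n+d≡o

attained-of-InL : ∀ {n m} → 1 < n → InL n m → Attained n m
attained-of-InL (s≤s (s≤s {n = s} z≤n)) (lowest refl) =
  subst (Attained (2 + s)) (sym (-[2+n]+2≡-n s)) (attained-lowest s)
attained-of-InL {n} {+ s} _ (middle _ s≤n-3) =
  let b , 3+b+s≡n = m+n≤o⇒∃[d]m+d+n≡o 3 (Equivalence.to +a≤+n-+b⇔b+a≤n s≤n-3)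
  in subst (λ n → Attained n (+ s)) 3+b+s≡n (attained-positive b s)
attained-of-InL {n} { -[1+ j ]} _ (middle -n+4≤-s _) =
  let b , 4+b+s≡n = m+n≤o⇒∃[d]m+d+n≡o 4 (Equivalence.to -+n++b≤-+a⇔b+a≤n -n+4≤-s)
  in subst (λ n → Attained n -[1+ j ]) 4+b+s≡n (attained-negative b (suc j))
attained-of-InL 1<n (nought refl)  = attained-nought 1<n
attained-of-InL _   (highest refl) = attained-highest _

proposition9p4 : (n : ℕ) → 1 < n → (m : ℤ) →
    (∃ λ (F : SetComp n) → signedKnapsack (1 ∷ (n ∸ 1) ∷ []) F ≡ m) ⇔ InL n m
proposition9p4 n 1<n m = mk⇔
  (λ (F , value≡m) →
     subst (InL n) (trans (sym (signedKnapsack[1,n-1]≡signedCount 1<n F)) value≡m)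
           (InL-of-profile (profile F)))
  (λ m∈L →
     let k , s , p , value≡m      = attained-of-InL 1<n m∈L
         F , len≡k , singletons≡s = realize p
     in F , trans (signedKnapsack[1,n-1]≡signedCount 1<n F)
                  (trans (cong₂ (signedCount n) len≡k singletons≡s) value≡m))
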